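{- Let $m,l\ge3$ with $l$ odd, and let $f\colon\mathbf C_m\to\mathbf C_l$ be a graph homomorphism. Then (1) $|\deg f|\le m/l$; (2) $\deg f$ has the same parity as $m$; and (3) if $m=4$ then $\deg f=0$.
   Context: $\mathbf C_m$ is the $m$-cycle with vertex set $\{0,\dots,m-1\}$, vertices adjacent iff they differ by exactly $1$ modulo $m$. For a graph $\mathbf G$, $\Delta_{\mathsf E}(\mathbf G)$ is the free Abelian group generated by oriented edges $[u,v]$, $(u,v)\in E(G)$, subject to $[u,v]=-[v,u]$. A homomorphism $f\colon\mathbf H\to\mathbf G$ induces $f_{\mathsf E}\colon\Delta_{\mathsf E}(\mathbf H)\to\Delta_{\mathsf E}(\mathbf G)$, $\sum_i c_i[u_i,v_i]\mapsto\sum_i c_i[f(u_i),f(v_i)]$. $O_m=[0,1]+[1,2]+\dots+[m-1,0]\in\Delta_{\mathsf E}(\mathbf C_m)$. For a homomorphism $f\colon\mathbf C_m\to\mathbf C_l$ there is a (unique) integer $\deg f$, the degree of $f$, with $f_{\mathsf E}(O_m)=\deg f\cdot O_l$. -}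

module Defs where

open import Data.Nat using (ℕ; zero; suc; _+_; _%_; NonZero)
open import Data.Fin using (Fin; toℕ; _≟_)
open import Data.Integer using (ℤ; +_; _-_; 0ℤ; _*_) renaming (_+_ to _+ℤ_)
open import Data.List using (List; map; foldr; allFin)
open import Data.Bool using (Bool; true; false; _∧_)
open import Relation.Nullary.Decidable using (⌊_⌋)
open import Relation.Binary.PropositionalEquality using (_≡_)
open import Data.Sum using (_⊎_)

-- The m-cycle C_m: vertex set Fin m, i ~ j iff they differ by exactly 1 mod m.
-- (Used only for m ≥ 3, so the cycle is a simple loopless graph.)
Adj : (m : ℕ) → .{{_ : NonZero m}} → Fin m → Fin m → Set
Adj m i j = (toℕ j ≡ (toℕ i + 1) % m) ⊎ (toℕ i ≡ (toℕ j + 1) % m)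

IsHom : (m l : ℕ) → .{{_ : NonZero m}} → .{{_ : NonZero l}} → (Fin m → Fin l) → Set
IsHom m l f = ∀ i j → Adj m i j → Adj l (f i) (f j)

-- Elements of Δ_E(C_l), represented by their antisymmetric coefficient
-- function on ordered pairs (a , b): the element Σ c [u,v] has value at
-- (a , b) equal to (coefficient of [a,b]) − (coefficient of [b,a]).
-- For a simple loopless graph this is the standard isomorphism of Δ_E with
-- antisymmetric integer functions supported on oriented edges.
ΔE : ℕ → Set
ΔE l = Fin l → Fin l → ℤ

ι : Bool → ℤ
ι true  = + 1
ι false = 0ℤ

gen : ∀ {l} → Fin l → Fin l → ΔE l
gen u v a b = ι (⌊ u ≟ a ⌋ ∧ ⌊ v ≟ b ⌋) - ι (⌊ v ≟ a ⌋ ∧ ⌊ u ≟ b ⌋)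

next : (m : ℕ) → .{{_ : NonZero m}} → Fin m → Fin m
next m i = Data.Fin.fromℕ< (Data.Nat.DivMod.m%n<n (toℕ i + 1) m)
  where import Data.Nat.DivMod
        import Data.Fin

sumΔ : ∀ {l} → List (ΔE l) → ΔE l
sumΔ xs a b = foldr _+ℤ_ 0ℤ (map (λ x → x a b) xs)

O : (m : ℕ) → .{{_ : NonZero m}} → ΔE m
O m = sumΔ (map (λ i → gen i (next m i)) (allFin m))

fEO : (m l : ℕ) → .{{_ : NonZero m}} → (Fin m → Fin l) → ΔE l
fEO m l f = sumΔ (map (λ i → gen (f i) (f (next m i))) (allFin m))

IsDegree : (m l : ℕ) → .{{_ : NonZero m}} → .{{_ : NonZero l}} → (Fin m → Fin l) → ℤ → Set
IsDegree m l f d = ∀ a b → fEO m l f a b ≡ d * O l a b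

{-# OPTIONS --safe #-}
module Submission where

-- Evaluate f_E(O_m) at the oriented edges [a, a+1] of C_l, writing T i a for the
-- contribution of the step [f i, f (i+1)]. Since l ≥ 3, the oriented edges [a, a+1] and
-- [b+1, b] never coincide, so each step contributes ±1 at exactly one edge [a, a+1], while
-- the degree equation says that the contributions at each edge add up to d. Hence
-- m = Σ_a Σ_i |T i a| ≥ l |d|, and modulo 2, m ≡ Σ_a Σ_i T i a = l d ≡ d as l is odd.
-- For m = 4 this leaves an even d with |d| ≤ 4/3.

open import Defs
open import Data.Nat using (ℕ; _≤_; _*_; NonZero)
open import Data.Integer using (ℤ; ∣_∣; +_; _-_; 0ℤ)
open import Data.Integer.Divisibility using (_∣_)
open import Data.Nat.Divisibility using () renaming (_∣_ to _∣ℕ_)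
open import Data.Fin using (Fin)
open import Data.Product using (_×_)
open import Relation.Binary.PropositionalEquality using (_≡_)
open import Relation.Nullary using (¬_)

import Algebra.Properties.CommutativeMonoid.Sum as MonoidSum
open import Data.Bool using (true; false; _∧_)
open import Data.Fin using (zero; suc; toℕ; _≟_)
import Data.Fin.Properties as FinP
open import Data.Integer as ℤ using (-[1+_])
import Data.Integer.Divisibility.Signed as Signed
import Data.Integer.Properties as ℤP
open import Data.Integer.Tactic.RingSolver using (solve-∀)
open import Data.List using (map; tabulate)
open import Data.Nat as ℕ using (zero; suc; _<_; _%_; _/_; s≤s; z≤n)
open import Data.Nat.Divisibility using (divides; ∣⇒≤; m%n≡0⇒n∣m)
import Data.Nat.DivMod as ℕDM
import Data.Nat.Properties as ℕP
open import Data.Product using (_,_)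
open import Data.Sum using (_⊎_; inj₁; inj₂)
import Data.Sum as Sum
open import Function using (_∘_; id)
open import Relation.Binary.PropositionalEquality
  using (_≢_; refl; sym; trans; cong; cong₂; subst; module ≡-Reasoning)
open import Relation.Nullary using (yes; no; contradiction)
open import Relation.Nullary.Decidable using (⌊_⌋; ⌊⌋-map′)

open ≡-Reasoning

module ℕΣ = MonoidSum ℕP.+-0-commutativeMonoid
module ℤΣ = MonoidSum ℤP.+-0-commutativeMonoid

∑ℕ-syntax : ∀ n → (Fin n → ℕ) → ℕ
∑ℕ-syntax _ = ℕΣ.sum

∑ℤ-syntax : ∀ n → (Fin n → ℤ) → ℤ
∑ℤ-syntax _ = ℤΣ.sum

syntax ∑ℕ-syntax n (λ i → x) = ∑ℕ[ i < n ] x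
syntax ∑ℤ-syntax n (λ i → x) = ∑ℤ[ i < n ] x

∑ℕ-const : ∀ n c → ∑ℕ[ i < n ] c ≡ n * c
∑ℕ-const zero    c = refl
∑ℕ-const (suc n) c = cong (c ℕ.+_) (∑ℕ-const n c)

∑ℤ-const : ∀ n c → ∑ℤ[ i < n ] c ≡ + n ℤ.* c
∑ℤ-const zero    c = sym (ℤP.*-zeroˡ c)
∑ℤ-const (suc n) c = trans (cong (ℤ._+_ c) (∑ℤ-const n c)) (sym (ℤP.suc-* (+ n) c))

∑ℕ-mono-≤ : ∀ {n} {g h : Fin n → ℕ} → (∀ i → g i ≤ h i) → ∑ℕ[ i < n ] g i ≤ ∑ℕ[ i < n ] h i
∑ℕ-mono-≤ {zero}  g≤h = z≤n
∑ℕ-mono-≤ {suc n} g≤h = ℕP.+-mono-≤ (g≤h zero) (∑ℕ-mono-≤ (g≤h ∘ suc))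

pos-∑ : ∀ {n} (g : Fin n → ℕ) → + ∑ℕ[ i < n ] g i ≡ ∑ℤ[ i < n ] (+ g i)
pos-∑ {zero}  g = refl
pos-∑ {suc n} g = trans (ℤP.pos-+ (g zero) _) (cong (ℤ._+_ (+ g zero)) (pos-∑ (g ∘ suc)))

∣∑∣≤∑∣∣ : ∀ {n} (g : Fin n → ℤ) → ∣ ∑ℤ[ i < n ] g i ∣ ≤ ∑ℕ[ i < n ] ∣ g i ∣
∣∑∣≤∑∣∣ {zero}  g = z≤n
∣∑∣≤∑∣∣ {suc n} g = ℕP.≤-trans (ℤP.∣i+j∣≤∣i∣+∣j∣ (g zero) _)
  (ℕP.+-monoʳ-≤ ∣ g zero ∣ (∣∑∣≤∑∣∣ (g ∘ suc)))

∑-congruent-mod-2 : ∀ {n} {g h : Fin n → ℤ} →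
  (∀ i → + 2 Signed.∣ g i - h i) → + 2 Signed.∣ ∑ℤ[ i < n ] g i - ∑ℤ[ i < n ] h i
∑-congruent-mod-2 {zero}          _   = Signed.divides 0ℤ refl
∑-congruent-mod-2 {suc n} {g} {h} g≡h-mod-2 =
  subst (+ 2 Signed.∣_) (sym (+-minus-interchange (g zero) _ (h zero) _))
    (Signed.∣m∣n⇒∣m+n (g≡h-mod-2 zero) (∑-congruent-mod-2 (g≡h-mod-2 ∘ suc)))
  where
  +-minus-interchange : ∀ a b c d → (a ℤ.+ b) - (c ℤ.+ d) ≡ (a - c) ℤ.+ (b - d)
  +-minus-interchange = solve-∀

i≡∣i∣-mod-2 : ∀ i → + 2 Signed.∣ i - + ∣ i ∣
i≡∣i∣-mod-2 (+ n)    = Signed.divides 0ℤ (ℤP.+-inverseʳ (+ n))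
i≡∣i∣-mod-2 -[1+ n ] = Signed.divides -[1+ n ] (i+i≡i*2 -[1+ n ])
  where
  i+i≡i*2 : ∀ i → i ℤ.+ i ≡ i ℤ.* + 2
  i+i≡i*2 = solve-∀

module _ {m l : ℕ} (T : Fin m → Fin l → ℤ) where

  rowSums⇒∑∑∣T∣≡m : (∀ i → ∑ℕ[ a < l ] ∣ T i a ∣ ≡ 1) → ∑ℕ[ a < l ] ∑ℕ[ i < m ] ∣ T i a ∣ ≡ m
  rowSums⇒∑∑∣T∣≡m rowSums = begin
    ∑ℕ[ a < l ] ∑ℕ[ i < m ] ∣ T i a ∣  ≡⟨ ℕΣ.∑-comm (λ a i → ∣ T i a ∣) ⟩
    ∑ℕ[ i < m ] ∑ℕ[ a < l ] ∣ T i a ∣  ≡⟨ ℕΣ.sum-cong-≗ rowSums ⟩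
    ∑ℕ[ i < m ] 1                      ≡⟨ ∑ℕ-const m 1 ⟩
    m * 1                              ≡⟨ ℕP.*-identityʳ m ⟩
    m                                  ∎

  columnSums⇒∣d∣*l≤∑∑∣T∣ : ∀ {d} → (∀ a → ∑ℤ[ i < m ] T i a ≡ d) →
    ∣ d ∣ * l ≤ ∑ℕ[ a < l ] ∑ℕ[ i < m ] ∣ T i a ∣
  columnSums⇒∣d∣*l≤∑∑∣T∣ {d} columnSums =
    subst (_≤ ∑ℕ[ a < l ] ∑ℕ[ i < m ] ∣ T i a ∣) (trans (∑ℕ-const l ∣ d ∣) (ℕP.*-comm l ∣ d ∣))
      (∑ℕ-mono-≤ column-bound)
    where
    column-bound : ∀ a → ∣ d ∣ ≤ ∑ℕ[ i < m ] ∣ T i a ∣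
    column-bound a = subst (λ t → ∣ t ∣ ≤ ∑ℕ[ i < m ] ∣ T i a ∣) (columnSums a) (∣∑∣≤∑∣∣ (λ i → T i a))

  columnSums⇒l*d≡∑∑∣T∣-mod-2 : ∀ {d} → (∀ a → ∑ℤ[ i < m ] T i a ≡ d) →
    + 2 Signed.∣ + l ℤ.* d - + (∑ℕ[ a < l ] ∑ℕ[ i < m ] ∣ T i a ∣)
  columnSums⇒l*d≡∑∑∣T∣-mod-2 {d} columnSums = subst (+ 2 Signed.∣_) (cong₂ _-_ ∑∑T ∑∑+∣T∣)
    (∑-congruent-mod-2 λ a → ∑-congruent-mod-2 λ i → i≡∣i∣-mod-2 (T i a))
    where
    ∑∑+∣T∣ : ∑ℤ[ a < l ] ∑ℤ[ i < m ] (+ ∣ T i a ∣) ≡ + (∑ℕ[ a < l ] ∑ℕ[ i < m ] ∣ T i a ∣)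
    ∑∑+∣T∣ = sym (trans (pos-∑ (λ a → ∑ℕ[ i < m ] ∣ T i a ∣)) (ℤΣ.sum-cong-≗ λ a → pos-∑ (λ i → ∣ T i a ∣)))
    ∑∑T : ∑ℤ[ a < l ] ∑ℤ[ i < m ] T i a ≡ + l ℤ.* d
    ∑∑T = trans (ℤΣ.sum-cong-≗ columnSums) (∑ℤ-const l d)

[m+k]%n≢m : ∀ {m k n} .{{_ : NonZero n}} .{{_ : NonZero k}} → k < n → (m ℕ.+ k) % n ≢ m
[m+k]%n≢m {m} {k} {n} k<n [m+k]%n≡m = ℕP.<⇒≱ k<n (∣⇒≤ (divides q k≡q*n))
  where
  q = (m ℕ.+ k) / n
  k≡q*n : k ≡ q * n
  k≡q*n = ℕP.+-cancelˡ-≡ m k (q * n) (begin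
    m ℕ.+ k                    ≡⟨ ℕDM.m≡m%n+[m/n]*n (m ℕ.+ k) n ⟩
    (m ℕ.+ k) % n ℕ.+ q * n    ≡⟨ cong (ℕ._+ q * n) [m+k]%n≡m ⟩
    m ℕ.+ q * n                ∎)

module _ {l : ℕ} .{{_ : NonZero l}} where

  toℕ-next : ∀ x → toℕ (next l x) ≡ (toℕ x ℕ.+ 1) % l
  toℕ-next x = FinP.toℕ-fromℕ< _

  toℕ-next∘next : ∀ x → toℕ (next l (next l x)) ≡ (toℕ x ℕ.+ 2) % l
  toℕ-next∘next x = begin
    toℕ (next l (next l x))            ≡⟨ toℕ-next (next l x) ⟩
    (toℕ (next l x) ℕ.+ 1) % l         ≡⟨ cong (λ y → (y ℕ.+ 1) % l) (toℕ-next x) ⟩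
    ((toℕ x ℕ.+ 1) % l ℕ.+ 1) % l      ≡⟨ ℕDM.%-distribˡ-+ ((toℕ x ℕ.+ 1) % l) 1 l ⟩
    ((toℕ x ℕ.+ 1) % l % l ℕ.+ 1 % l) % l
      ≡⟨ cong (λ y → (y ℕ.+ 1 % l) % l) (ℕDM.m%n%n≡m%n (toℕ x ℕ.+ 1) l) ⟩
    ((toℕ x ℕ.+ 1) % l ℕ.+ 1 % l) % l  ≡⟨ ℕDM.%-distribˡ-+ (toℕ x ℕ.+ 1) 1 l ⟨
    (toℕ x ℕ.+ 1 ℕ.+ 1) % l            ≡⟨ cong (_% l) (ℕP.+-assoc (toℕ x) 1 1) ⟩
    (toℕ x ℕ.+ 2) % l                  ∎

  next∘next-≢ : 2 < l → ∀ x → next l (next l x) ≢ x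
  next∘next-≢ 2<l x next²≡x = [m+k]%n≢m 2<l (trans (sym (toℕ-next∘next x)) (cong toℕ next²≡x))

  Adj⇒next : ∀ {u v} → Adj l u v → v ≡ next l u ⊎ u ≡ next l v
  Adj⇒next {u} {v} = Sum.map (λ e → FinP.toℕ-injective (trans e (sym (toℕ-next u))))
                             (λ e → FinP.toℕ-injective (trans e (sym (toℕ-next v))))

module _ {n : ℕ} where

  ⌊≟⌋-≡ : {i j : Fin n} → i ≡ j → ⌊ i ≟ j ⌋ ≡ true
  ⌊≟⌋-≡ {i} {j} i≡j with i ≟ j
  ... | yes _   = refl
  ... | no  i≢j = contradiction i≡j i≢j

  ⌊≟⌋-≢ : {i j : Fin n} → i ≢ j → ⌊ i ≟ j ⌋ ≡ false
  ⌊≟⌋-≢ {i} {j} i≢j with i ≟ j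
  ... | yes i≡j = contradiction i≡j i≢j
  ... | no  _   = refl

  ⌊≟⌋-sym : (i j : Fin n) → ⌊ i ≟ j ⌋ ≡ ⌊ j ≟ i ⌋
  ⌊≟⌋-sym i j with i ≟ j
  ... | yes i≡j = sym (⌊≟⌋-≡ (sym i≡j))
  ... | no  i≢j = sym (⌊≟⌋-≢ (i≢j ∘ sym))

∑∣ι≟∣≡1 : ∀ {n} (c : Fin n) → ∑ℕ[ a < n ] ∣ ι ⌊ c ≟ a ⌋ ∣ ≡ 1
∑∣ι≟∣≡1 {suc n} zero    = cong suc (ℕΣ.sum-replicate-zero n)
∑∣ι≟∣≡1 {suc n} (suc c) =
  trans (ℕΣ.sum-cong-≗ λ a → cong (∣_∣ ∘ ι) (⌊⌋-map′ _ _ (c ≟ a))) (∑∣ι≟∣≡1 c)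

∑ι≟≡1 : ∀ {n} (a : Fin n) → ∑ℤ[ c < n ] ι ⌊ c ≟ a ⌋ ≡ + 1
∑ι≟≡1 {n} a = begin
  ∑ℤ[ c < n ] ι ⌊ c ≟ a ⌋          ≡⟨ ℤΣ.sum-cong-≗ (λ c → cong ι (⌊≟⌋-sym c a)) ⟩
  ∑ℤ[ c < n ] ι ⌊ a ≟ c ⌋          ≡⟨ ℤΣ.sum-cong-≗ (λ c → ι≡+∣ι∣ ⌊ a ≟ c ⌋) ⟩
  ∑ℤ[ c < n ] (+ ∣ ι ⌊ a ≟ c ⌋ ∣)  ≡⟨ pos-∑ (λ c → ∣ ι ⌊ a ≟ c ⌋ ∣) ⟨
  + ∑ℕ[ c < n ] ∣ ι ⌊ a ≟ c ⌋ ∣    ≡⟨ cong +_ (∑∣ι≟∣≡1 a) ⟩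
  + 1                               ∎
  where
  ι≡+∣ι∣ : ∀ b → ι b ≡ + ∣ ι b ∣
  ι≡+∣ι∣ true  = refl
  ι≡+∣ι∣ false = refl

module _ {l : ℕ} .{{_ : NonZero l}} (2<l : 2 < l) where

  private
    same-orientation : (u a : Fin l) → ⌊ u ≟ a ⌋ ∧ ⌊ next l u ≟ next l a ⌋ ≡ ⌊ u ≟ a ⌋
    same-orientation u a with u ≟ a
    ... | yes refl = ⌊≟⌋-≡ refl
    ... | no  _    = refl

    opposite-orientation : (u a : Fin l) → ⌊ next l u ≟ a ⌋ ∧ ⌊ u ≟ next l a ⌋ ≡ false
    opposite-orientation u a with next l u ≟ a
    ... | yes refl = ⌊≟⌋-≢ (next∘next-≢ 2<l u ∘ sym)
    ... | no  _    = refl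

  gen-forward : (u a : Fin l) → gen u (next l u) a (next l a) ≡ ι ⌊ u ≟ a ⌋
  gen-forward u a = trans (cong₂ (λ p q → ι p - ι q) (same-orientation u a) (opposite-orientation u a))
                          (ℤP.+-identityʳ (ι ⌊ u ≟ a ⌋))

  gen-backward : (v a : Fin l) → gen (next l v) v a (next l a) ≡ ℤ.- ι ⌊ v ≟ a ⌋
  gen-backward v a = trans (cong₂ (λ p q → ι p - ι q) (opposite-orientation v a) (same-orientation v a))
                           (ℤP.+-identityˡ (ℤ.- ι ⌊ v ≟ a ⌋))

  ∑∣gen∣≡1 : ∀ {u v} → Adj l u v → ∑ℕ[ a < l ] ∣ gen u v a (next l a) ∣ ≡ 1
  ∑∣gen∣≡1 {u} {v} u~v with Adj⇒next u~v
  ... | inj₁ refl = trans (ℕΣ.sum-cong-≗ λ a → cong ∣_∣ (gen-forward u a)) (∑∣ι≟∣≡1 u)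
  ... | inj₂ refl = trans (ℕΣ.sum-cong-≗ λ a → trans (cong ∣_∣ (gen-backward v a)) (ℤP.∣-i∣≡∣i∣ (ι ⌊ v ≟ a ⌋)))
                          (∑∣ι≟∣≡1 v)

sumΔ-map-tabulate : ∀ {A : Set} {n l} (g : A → ΔE l) (h : Fin n → A) (a b : Fin l) →
  sumΔ (map g (tabulate h)) a b ≡ ∑ℤ[ i < n ] g (h i) a b
sumΔ-map-tabulate {n = zero}  g h a b = refl
sumΔ-map-tabulate {n = suc n} g h a b = cong (ℤ._+_ (g (h zero) a b)) (sumΔ-map-tabulate g (h ∘ suc) a b)

O-next≡1 : ∀ {l} .{{_ : NonZero l}} → 2 < l → (a : Fin l) → O l a (next l a) ≡ + 1
O-next≡1 {l} 2<l a = begin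
  O l a (next l a)                                     ≡⟨ sumΔ-map-tabulate (λ c → gen c (next l c)) id a (next l a) ⟩
  ∑ℤ[ c < l ] gen c (next l c) a (next l a)            ≡⟨ ℤΣ.sum-cong-≗ (λ c → gen-forward 2<l c a) ⟩
  ∑ℤ[ c < l ] ι ⌊ c ≟ a ⌋                              ≡⟨ ∑ι≟≡1 a ⟩
  + 1                                                  ∎

stepCoeff : ∀ m l .{{_ : NonZero m}} .{{_ : NonZero l}} → (Fin m → Fin l) → Fin m → Fin l → ℤ
stepCoeff m l f i a = gen (f i) (f (next m i)) a (next l a)

module _ {m l : ℕ} .{{_ : NonZero m}} .{{_ : NonZero l}} (2<l : 2 < l) (f : Fin m → Fin l) where

  IsHom⇒∑∣stepCoeff∣≡1 : IsHom m l f → ∀ i → ∑ℕ[ a < l ] ∣ stepCoeff m l f i a ∣ ≡ 1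
  IsHom⇒∑∣stepCoeff∣≡1 hom i = ∑∣gen∣≡1 2<l (hom i (next m i) (inj₁ (toℕ-next i)))

  IsDegree⇒∑stepCoeff≡d : ∀ {d} → IsDegree m l f d → ∀ a → ∑ℤ[ i < m ] stepCoeff m l f i a ≡ d
  IsDegree⇒∑stepCoeff≡d {d} deg a = begin
    ∑ℤ[ i < m ] stepCoeff m l f i a
      ≡⟨ sumΔ-map-tabulate (λ i → gen (f i) (f (next m i))) id a (next l a) ⟨
    fEO m l f a (next l a)  ≡⟨ deg a (next l a) ⟩
    d ℤ.* O l a (next l a)  ≡⟨ cong (d ℤ.*_) (O-next≡1 2<l a) ⟩
    d ℤ.* + 1               ≡⟨ ℤP.*-identityʳ d ⟩
    d                       ∎

odd⇒≡1+[n/2]*2 : ∀ {n} → ¬ 2 ∣ℕ n → n ≡ 1 ℕ.+ n / 2 * 2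
odd⇒≡1+[n/2]*2 {n} n-odd with n % 2 in n%2≡r | ℕDM.m%n<n n 2
... | 0           | _                = contradiction (m%n≡0⇒n∣m n 2 n%2≡r) n-odd
... | 1           | _                = trans (ℕDM.m≡m%n+[m/n]*n n 2) (cong (ℕ._+ n / 2 * 2) n%2≡r)
... | suc (suc _) | s≤s (s≤s ())

d≡l*d-mod-2 : ∀ {l} → ¬ 2 ∣ℕ l → ∀ d → + 2 Signed.∣ d - + l ℤ.* d
d≡l*d-mod-2 {l} l-odd d = Signed.divides (ℤ.- (+ k ℤ.* d)) (begin
  d - + l ℤ.* d                          ≡⟨ cong (λ t → d - t ℤ.* d) +l≡1+k*2 ⟩
  d - (+ 1 ℤ.+ + k ℤ.* + 2) ℤ.* d        ≡⟨ d-[1+2k]d≡-kd*2 d (+ k) ⟩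
  ℤ.- (+ k ℤ.* d) ℤ.* + 2                ∎)
  where
  k = l / 2
  +l≡1+k*2 : + l ≡ + 1 ℤ.+ + k ℤ.* + 2
  +l≡1+k*2 = trans (cong +_ (odd⇒≡1+[n/2]*2 l-odd))
                   (trans (ℤP.pos-+ 1 (k * 2)) (cong (ℤ._+_ (+ 1)) (ℤP.pos-* k 2)))
  d-[1+2k]d≡-kd*2 : ∀ d k → d - (+ 1 ℤ.+ k ℤ.* + 2) ℤ.* d ≡ ℤ.- (k ℤ.* d) ℤ.* + 2
  d-[1+2k]d≡-kd*2 = solve-∀

even-<2⇒≡0 : ∀ {n} → 2 ∣ℕ n → n < 2 → n ≡ 0
even-<2⇒≡0 {0}           _   _                = refl
even-<2⇒≡0 {1}           2∣1 _                = contradiction (∣⇒≤ 2∣1) λ { (s≤s ()) }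
even-<2⇒≡0 {suc (suc _)} _   (s≤s (s≤s ()))

∣d∣*l≤4⇒d≡0 : ∀ {l d} → 2 < l → ∣ d ∣ * l ≤ 4 → + 2 Signed.∣ d - + 4 → d ≡ 0ℤ
∣d∣*l≤4⇒d≡0 {l} {d} 2<l ∣d∣*l≤4 d≡4-mod-2 = ℤP.∣i∣≡0⇒i≡0 (even-<2⇒≡0 (Signed.∣⇒∣ᵤ 2∣d) ∣d∣<2)
  where
  2∣d : + 2 Signed.∣ d
  2∣d = Signed.∣m+n∣n⇒∣m d≡4-mod-2 (Signed.divides (ℤ.- + 2) refl)
  ∣d∣<2 : ∣ d ∣ < 2
  ∣d∣<2 = ℕP.*-cancelʳ-< l ∣ d ∣ 2
    (ℕP.≤-<-trans ∣d∣*l≤4 (ℕP.≤-trans (ℕP.n≤1+n 5) (ℕP.*-monoʳ-≤ 2 2<l)))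

lemma5p3 : (m l : ℕ) → .{{_ : NonZero m}} → .{{_ : NonZero l}} →
    3 ≤ m → 3 ≤ l → ¬ (2 ∣ℕ l) →
    (f : Fin m → Fin l) → IsHom m l f →
    (d : ℤ) → IsDegree m l f d →
    (∣ d ∣ * l ≤ m) × ((+ 2) ∣ (d - + m)) × (m ≡ 4 → d ≡ 0ℤ)
lemma5p3 m l _ 2<l l-odd f hom d deg = bound , Signed.∣⇒∣ᵤ d≡m-mod-2 , m≡4⇒d≡0
  where
  T = stepCoeff m l f
  columnSums = IsDegree⇒∑stepCoeff≡d 2<l f deg
  ∑∑∣T∣≡m : ∑ℕ[ a < l ] ∑ℕ[ i < m ] ∣ T i a ∣ ≡ m
  ∑∑∣T∣≡m = rowSums⇒∑∑∣T∣≡m T (IsHom⇒∑∣stepCoeff∣≡1 2<l f hom)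

  bound : ∣ d ∣ * l ≤ m
  bound = subst (∣ d ∣ * l ≤_) ∑∑∣T∣≡m (columnSums⇒∣d∣*l≤∑∑∣T∣ T columnSums)

  d≡m-mod-2 : + 2 Signed.∣ d - + m
  d≡m-mod-2 = subst (λ s → + 2 Signed.∣ d - + s) ∑∑∣T∣≡m
    (subst (+ 2 Signed.∣_) (ℤP.+-minus-telescope d (+ l ℤ.* d) _)
      (Signed.∣m∣n⇒∣m+n (d≡l*d-mod-2 l-odd d) (columnSums⇒l*d≡∑∑∣T∣-mod-2 T columnSums)))

  m≡4⇒d≡0 : m ≡ 4 → d ≡ 0ℤ
  m≡4⇒d≡0 refl = ∣d∣*l≤4⇒d≡0 2<l bound d≡m-mod-2
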